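{- Let $f: A^*\to B^*$ be a non-erasing morphism that is strongly quasiperiodic on infinite words. Then for every finite word $u$ over $A$ and every letter $\alpha\in A$, the quasiperiod of the infinite word $f(u\alpha^\omega)$ is a factor of $f(\alpha)^3$ of length less than $2|f(\alpha)|$.
   Context: $\alpha^\omega$ denotes the infinite word $\alpha\alpha\alpha\cdots$. For a non-empty word $q$, an infinite word $\mathbf{x}$ is $q$-quasiperiodic if every position of $\mathbf{x}$ lies within some occurrence of $q$ in $\mathbf{x}$; it is quasiperiodic if it is $q$-quasiperiodic for some $q$, and its quasiperiod is the shortest such $q$. The morphism $f$ is strongly quasiperiodic on infinite words if $f(\mathbf{w})$ is quasiperiodic for every infinite word $\mathbf{w}$ over $A$. -}

module Defs where

open import Data.Nat using (ℕ; zero; suc; _+_; _≤_; _<_)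
open import Data.List using (List; []; _∷_; length; _++_)
open import Data.List.NonEmpty using (List⁺; _∷_; toList)
import Data.List.NonEmpty as L⁺
open import Data.Product using (Σ; ∃; _×_; _,_)
open import Relation.Binary.PropositionalEquality using (_≡_; _≢_)

InfWord : Set → Set
InfWord X = ℕ → X

-- A non-erasing morphism f : A* → B* is determined by the images of the
-- letters, each a non-empty word.
NonErasingMorphism : Set → Set → Set
NonErasingMorphism A B = A → List⁺ B

data _at_≡_ {X : Set} : List X → ℕ → X → Set where
  here  : ∀ {x xs} → (x ∷ xs) at zero ≡ x
  there : ∀ {x xs n y} → xs at n ≡ y → (x ∷ xs) at suc n ≡ y

-- Image of an infinite word under a non-erasing morphism.
-- go (current non-empty remainder of an image block) (remaining letters) n
imageGo : {A B : Set} → NonErasingMorphism A B → List⁺ B → InfWord A → ℕ → B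
imageGo f (b ∷ bs)     w zero    = b
imageGo f (b ∷ [])     w (suc n) = imageGo f (f (w 0)) (λ k → w (suc k)) n
imageGo f (b ∷ c ∷ bs) w (suc n) = imageGo f (c ∷ bs) w n

image : {A B : Set} → NonErasingMorphism A B → InfWord A → InfWord B
image f w = imageGo f (f (w 0)) (λ k → w (suc k))

_·_^ω : {A : Set} → List A → A → InfWord A
([]    · α ^ω) n       = α
((a ∷ u) · α ^ω) zero    = a
((a ∷ u) · α ^ω) (suc n) = (u · α ^ω) n

OccursAt : {B : Set} → List B → InfWord B → ℕ → Set
OccursAt q x i = ∀ j (b : _) → q at j ≡ b → x (i + j) ≡ b

IsQuasiperiodic : {B : Set} → InfWord B → List B → Set
IsQuasiperiodic x q =
  q ≢ [] × (∀ p → Σ ℕ λ i → OccursAt q x i × i ≤ p × p < i + length q)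

Quasiperiodic : {B : Set} → InfWord B → Set
Quasiperiodic x = ∃ λ q → IsQuasiperiodic x q

IsQuasiperiodOf : {B : Set} → List B → InfWord B → Set
IsQuasiperiodOf q x =
  IsQuasiperiodic x q × (∀ q′ → IsQuasiperiodic x q′ → length q ≤ length q′)

StronglyQuasiperiodic : {A B : Set} → NonErasingMorphism A B → Set
StronglyQuasiperiodic {A} f = ∀ (w : InfWord A) → Quasiperiodic (image f w)

Factor : {X : Set} → List X → List X → Set
Factor {X} q v = Σ (List X) λ p → Σ (List X) λ s → p ++ q ++ s ≡ v

-- Past the prefix f(u), the word x = f(u α^ω) coincides with f(α)^ω, which has period
-- m = |f(α)|. Since x is q-quasiperiodic, some occurrence of q lies in that periodic tail, so q
-- itself has period m. If |q| ≥ 2m, dropping the last m letters of q still gives a quasiperiod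
-- (the occurrence shifted by m covers what is lost), contradicting minimality; hence |q| < 2m.
-- Moving the occurrence back by a multiple of m to a start r < m, q sits inside the prefix of
-- f(α)^ω of length r + |q| < 3m, i.e. inside f(α)^3.
module Submission where

open import Defs
open import Data.Nat using (_<_; _*_)
open import Data.List using (List; length; _++_)
open import Data.List.NonEmpty using (toList)
import Data.List.NonEmpty as L⁺
open import Data.Product using (_×_)

open import Data.Nat using (ℕ; zero; suc; _+_; _∸_; _≤_; z≤n; s≤s; NonZero; _%_; _/_; _⊓_; _<?_; _≤?_; >-nonZero⁻¹)
open import Data.Nat.Properties
open import Data.Nat.DivMod using (m≡m%n+[m/n]*n; m%n<n)
open import Data.List using ([]; _∷_; take; drop)
open import Data.List.Properties using (length-take; take++drop≡id; length-++)
open import Data.List.NonEmpty using (List⁺; _∷_)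
open import Data.Product using (Σ; ∃; _,_; proj₁; proj₂)
open import Relation.Nullary using (yes; no; contradiction)
open import Relation.Binary.PropositionalEquality

private
  variable
    X A B : Set

at-<-length : {xs : List X} {j : ℕ} {b : X} → xs at j ≡ b → j < length xs
at-<-length here      = s≤s z≤n
at-<-length (there p) = s≤s (at-<-length p)

<-length⇒at : (xs : List X) (j : ℕ) → j < length xs → ∃ λ b → xs at j ≡ b
<-length⇒at (x ∷ xs) zero    _        = x , here
<-length⇒at (x ∷ xs) (suc j) (s≤s lt) with <-length⇒at xs j lt
... | b , p = b , there p

at-take⁻ : (n : ℕ) (xs : List X) {j : ℕ} {b : X} → take n xs at j ≡ b → xs at j ≡ b
at-take⁻ (suc n) (x ∷ xs) here      = here
at-take⁻ (suc n) (x ∷ xs) (there p) = there (at-take⁻ n xs p)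

at-drop⁺ : (r : ℕ) (xs : List X) {j : ℕ} {b : X} → xs at (r + j) ≡ b → drop r xs at j ≡ b
at-drop⁺ zero    xs       p         = p
at-drop⁺ (suc r) (x ∷ xs) (there p) = at-drop⁺ r xs p

prefix⇒++-drop-length : (q xs : List X) → (∀ j b → q at j ≡ b → xs at j ≡ b) →
  q ++ drop (length q) xs ≡ xs
prefix⇒++-drop-length []      xs       _ = refl
prefix⇒++-drop-length (x ∷ q) []       h with h 0 x here
... | ()
prefix⇒++-drop-length (x ∷ q) (y ∷ xs) h with h 0 x here
... | here = cong (x ∷_) (prefix⇒++-drop-length q xs λ j b p → untail (h (suc j) b (there p)))
  where
  untail : ∀ {j b} → (y ∷ xs) at suc j ≡ b → xs at j ≡ b
  untail (there p) = p

length-toList : (l : List⁺ X) → length (toList l) ≡ L⁺.length l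
length-toList (_ ∷ _) = refl

nonZero-length-toList : (l : List⁺ X) → NonZero (length (toList l))
nonZero-length-toList (_ ∷ _) = _

length-cube : (xs : List X) → length (xs ++ xs ++ xs) ≡ 3 * length xs
length-cube xs = begin
  length (xs ++ xs ++ xs) ≡⟨ length-++ xs ⟩
  n + length (xs ++ xs)   ≡⟨ cong (n +_) (length-++ xs) ⟩
  n + (n + n)             ≡⟨ cong (λ k → n + (n + k)) (+-identityʳ n) ⟨
  3 * n ∎
  where
  n = length xs
  open ≡-Reasoning

imageGo-skip : (f : NonErasingMorphism A B) (b : B) (bs : List B) (w : InfWord A) (k : ℕ) →
  imageGo f (b ∷ bs) w (L⁺.length (b ∷ bs) + k) ≡ image f w k
imageGo-skip f b []       w k = refl
imageGo-skip f b (c ∷ bs) w k = imageGo-skip f c bs w k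

imageGo-skip⁺ : (f : NonErasingMorphism A B) (l : List⁺ B) (w : InfWord A) (k : ℕ) →
  imageGo f l w (length (toList l) + k) ≡ image f w k
imageGo-skip⁺ f (b ∷ bs) = imageGo-skip f b bs

imageGo-at : (f : NonErasingMorphism A B) (b : B) (bs : List B) (w : InfWord A) →
  OccursAt (b ∷ bs) (imageGo f (b ∷ bs) w) 0
imageGo-at f b []       w zero    .b here      = refl
imageGo-at f b (c ∷ bs) w zero    .b here      = refl
imageGo-at f b (c ∷ bs) w (suc j) b′ (there p) = imageGo-at f c bs w j b′ p

imageGo-at⁺ : (f : NonErasingMorphism A B) (l : List⁺ B) (w : InfWord A) →
  OccursAt (toList l) (imageGo f l w) 0
imageGo-at⁺ f (b ∷ bs) = imageGo-at f b bs

imageLength : NonErasingMorphism A B → List A → ℕ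
imageLength f []      = 0
imageLength f (a ∷ u) = length (toList (f a)) + imageLength f u

image-·^ω-drop : (f : NonErasingMorphism A B) (u : List A) (α : A) (k : ℕ) →
  image f (u · α ^ω) (imageLength f u + k) ≡ image f ([] · α ^ω) k
image-·^ω-drop f []      α k = refl
image-·^ω-drop f (a ∷ u) α k = begin
  image f ((a ∷ u) · α ^ω) (length (toList (f a)) + imageLength f u + k)
    ≡⟨ cong (image f ((a ∷ u) · α ^ω)) (+-assoc (length (toList (f a))) (imageLength f u) k) ⟩
  image f ((a ∷ u) · α ^ω) (length (toList (f a)) + (imageLength f u + k))
    ≡⟨ imageGo-skip⁺ f (f a) (u · α ^ω) (imageLength f u + k) ⟩
  image f (u · α ^ω) (imageLength f u + k)
    ≡⟨ image-·^ω-drop f u α k ⟩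
  image f ([] · α ^ω) k ∎
  where open ≡-Reasoning

Periodic : ℕ → InfWord X → Set
Periodic m y = ∀ k → y (m + k) ≡ y k

HasPeriod : ℕ → List X → Set
HasPeriod {X} m q = ∀ j (b b′ : X) → q at j ≡ b → q at (m + j) ≡ b′ → b ≡ b′

image-α^ω-periodic : (f : NonErasingMorphism A B) (α : A) →
  Periodic (length (toList (f α))) (image f ([] · α ^ω))
image-α^ω-periodic f α = imageGo-skip⁺ f (f α) (λ _ → α)

periodic-*+ : {m : ℕ} {y : InfWord X} → Periodic m y → ∀ n k → y (n * m + k) ≡ y k
periodic-*+         per zero    k = refl
periodic-*+ {m = m} {y} per (suc n) k =
  trans (cong y (+-assoc m (n * m) k)) (trans (per _) (periodic-*+ per n k))

occursAt-++ : {y : InfWord X} {o : ℕ} (P L : List X) →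
  OccursAt P y o → OccursAt L y (o + length P) → OccursAt (P ++ L) y o
occursAt-++ {y = y} {o} [] L _ occL k b p =
  subst (λ z → y (z + k) ≡ b) (+-identityʳ o) (occL k b p)
occursAt-++ (x ∷ P) L occP occL zero    b here      = occP zero b here
occursAt-++ {y = y} {o} (x ∷ P) L occP occL (suc k) b (there p) =
  trans (cong y (+-suc o k)) (occursAt-++ {y = y} {o = suc o} P L
    (λ k′ b′ p′ → trans (cong y (sym (+-suc o k′))) (occP (suc k′) b′ (there p′)))
    (λ k′ b′ p′ → trans (cong (λ z → y (z + k′)) (sym (+-suc o (length P)))) (occL k′ b′ p′))
    k b p)

occursAt-+period : {m : ℕ} {y : InfWord X} {q : List X} {s : ℕ} → Periodic m y →
  OccursAt q y s → OccursAt q y (s + m)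
occursAt-+period {m = m} {y} {s = s} per occ j b p = begin
  y (s + m + j)   ≡⟨ cong (λ z → y (z + j)) (+-comm s m) ⟩
  y (m + s + j)   ≡⟨ cong y (+-assoc m s j) ⟩
  y (m + (s + j)) ≡⟨ per (s + j) ⟩
  y (s + j)       ≡⟨ occ j b p ⟩
  b ∎
  where open ≡-Reasoning

occursAt-%period : {m : ℕ} .{{_ : NonZero m}} {y : InfWord X} {q : List X} {s : ℕ} →
  Periodic m y → OccursAt q y s → OccursAt q y (s % m)
occursAt-%period {m = m} {y} {s = s} per occ j b p = begin
  y (s % m + j)               ≡⟨ periodic-*+ per (s / m) (s % m + j) ⟨
  y (s / m * m + (s % m + j)) ≡⟨ cong y (+-comm (s / m * m) _) ⟩
  y (s % m + j + s / m * m)   ≡⟨ cong y (+-assoc (s % m) j _) ⟩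
  y (s % m + (j + s / m * m)) ≡⟨ cong (λ z → y (s % m + z)) (+-comm j _) ⟩
  y (s % m + (s / m * m + j)) ≡⟨ cong y (+-assoc (s % m) _ j) ⟨
  y (s % m + s / m * m + j)   ≡⟨ cong (λ z → y (z + j)) (m≡m%n+[m/n]*n s m) ⟨
  y (s + j)                   ≡⟨ occ j b p ⟩
  b ∎
  where open ≡-Reasoning

occursAt-cube : {y : InfWord X} (t : List X) → Periodic (length t) y →
  OccursAt t y 0 → OccursAt (t ++ t ++ t) y 0
occursAt-cube {y = y} t per occ = occursAt-++ {y = y} t (t ++ t) occ
  (occursAt-++ {y = y} t t occ′ (occursAt-+period {y = y} per occ′))
  where
  occ′ : OccursAt t y (length t)
  occ′ = occursAt-+period {y = y} per occ

occursAt-periodic⇒HasPeriod : {m : ℕ} {y : InfWord X} {q : List X} {s : ℕ} →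
  Periodic m y → OccursAt q y s → HasPeriod m q
occursAt-periodic⇒HasPeriod {m = m} {y} {s = s} per occ j b b′ p p′ = begin
  b               ≡⟨ occ j b p ⟨
  y (s + j)       ≡⟨ per (s + j) ⟨
  y (m + (s + j)) ≡⟨ cong y (+-assoc m s j) ⟨
  y (m + s + j)   ≡⟨ cong (λ z → y (z + j)) (+-comm m s) ⟩
  y (s + m + j)   ≡⟨ cong y (+-assoc s m j) ⟩
  y (s + (m + j)) ≡⟨ occ (m + j) b′ p′ ⟩
  b′ ∎
  where open ≡-Reasoning

occursAt-nested⇒Factor : {y : InfWord X} {q T : List X} {r : ℕ} →
  OccursAt T y 0 → OccursAt q y r → r + length q ≤ length T → Factor q T
occursAt-nested⇒Factor {y = y} {q} {T} {r} occT occq r+q≤T =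
  take r T , drop (length q) (drop r T) ,
  trans (cong (take r T ++_) (prefix⇒++-drop-length q (drop r T) q-prefix)) (take++drop≡id r T)
  where
  q-prefix : ∀ j b → q at j ≡ b → drop r T at j ≡ b
  q-prefix j b p with <-length⇒at T (r + j) (<-≤-trans (+-monoʳ-< r (at-<-length p)) r+q≤T)
  ... | b′ , pT = subst (drop r T at j ≡_) (trans (sym (occT (r + j) b′ pT)) (occq j b p))
                    (at-drop⁺ r T pT)

quasiperiod-occursAt-tail : {x y : InfWord X} {q : List X} (c : ℕ) →
  (∀ k → x (c + k) ≡ y k) → IsQuasiperiodic x q → ∃ λ s → OccursAt q y s
quasiperiod-occursAt-tail {x = x} {y} {q} c x≡y (_ , cover) with cover (c + length q)
... | i , occ , _ , c+q<i+q = i ∸ c , λ j b p → begin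
  y (i ∸ c + j)       ≡⟨ x≡y (i ∸ c + j) ⟨
  x (c + (i ∸ c + j)) ≡⟨ cong x (+-assoc c (i ∸ c) j) ⟨
  x (c + (i ∸ c) + j) ≡⟨ cong (λ z → x (z + j)) (m+[n∸m]≡n (<⇒≤ (+-cancelʳ-< (length q) c i c+q<i+q))) ⟩
  x (i + j)           ≡⟨ occ j b p ⟩
  b ∎
  where open ≡-Reasoning

-- With n = |q| − m ≥ m, a position missed by the occurrence of take n q at i is covered by the
-- one at i + m, which is an occurrence because q has period m.
quasiperiodic-take-∸period : {x : InfWord X} {q : List X} {m : ℕ} → 0 < m → HasPeriod m q →
  m + m ≤ length q → IsQuasiperiodic x q → IsQuasiperiodic x (take (length q ∸ m) q)
quasiperiodic-take-∸period {x = x} {q} {m} 0<m per m+m≤q (_ , cover) = nonEmpty , cover′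
  where
  n = length q ∸ m
  m+n≡q : m + n ≡ length q
  m+n≡q = m+[n∸m]≡n (m+n≤o⇒m≤o m m+m≤q)
  m≤n : m ≤ n
  m≤n = +-cancelˡ-≤ m m n (subst (m + m ≤_) (sym m+n≡q) m+m≤q)
  length-q′ : length (take n q) ≡ n
  length-q′ = trans (length-take n q) (m≤n⇒m⊓n≡m (m∸n≤m (length q) m))
  nonEmpty : take n q ≢ []
  nonEmpty eq = <⇒≢ (<-≤-trans 0<m m≤n) (sym (trans (sym length-q′) (cong length eq)))
  shifted : ∀ {i} → OccursAt q x i → OccursAt (take n q) x (i + m)
  shifted {i} occ j b p with <-length⇒at q (m + j)
      (subst (m + j <_) m+n≡q (+-monoʳ-< m (subst (j <_) length-q′ (at-<-length p))))
  ... | b′ , p′ = trans (cong x (+-assoc i m j))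
                    (trans (occ (m + j) b′ p′) (sym (per j b b′ (at-take⁻ n q p) p′)))
  cover′ : ∀ p → Σ ℕ λ i → OccursAt (take n q) x i × i ≤ p × p < i + length (take n q)
  cover′ p with cover p
  ... | i , occ , i≤p , p<i+q with p <? i + n
  ...   | yes p<i+n = i , (λ j b pa → occ j b (at-take⁻ n q pa)) , i≤p ,
                      subst (λ z → p < i + z) (sym length-q′) p<i+n
  ...   | no  p≮i+n = i + m , shifted {i} occ , ≤-trans (+-monoʳ-≤ i m≤n) (≮⇒≥ p≮i+n) ,
                      subst (p <_) (trans (cong (i +_) (trans (sym m+n≡q) (cong (m +_) (sym length-q′))))
                                          (sym (+-assoc i m _))) p<i+q

quasiperiod-length-< : {x : InfWord X} {q : List X} {m : ℕ} → 0 < m → HasPeriod m q →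
  IsQuasiperiodOf q x → length q < 2 * m
quasiperiod-length-< {x = x} {q} {m} 0<m per (qp , shortest) with 2 * m ≤? length q
... | no  2m≰q = ≰⇒> 2m≰q
... | yes 2m≤q = contradiction (shortest _ (quasiperiodic-take-∸period {x = x} 0<m per m+m≤q qp)) (<⇒≱ shorter)
  where
  m+m≤q : m + m ≤ length q
  m+m≤q = subst (_≤ length q) (cong (m +_) (+-identityʳ m)) 2m≤q
  shorter : length (take (length q ∸ m) q) < length q
  shorter = begin-strict
    length (take (length q ∸ m) q) ≡⟨ length-take (length q ∸ m) q ⟩
    (length q ∸ m) ⊓ length q      ≤⟨ m⊓n≤m _ _ ⟩
    length q ∸ m                   <⟨ ∸-monoʳ-< 0<m (m+n≤o⇒m≤o m m+m≤q) ⟩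
    length q                       ∎
    where open ≤-Reasoning

quasiperiod-in-periodic-tail : {x y : InfWord X} {q t : List X} .{{_ : NonZero (length t)}}
  (c : ℕ) → (∀ k → x (c + k) ≡ y k) → Periodic (length t) y → OccursAt t y 0 →
  IsQuasiperiodOf q x → Factor q (t ++ t ++ t) × length q < 2 * length t
quasiperiod-in-periodic-tail {x = x} {y} {q} {t} c x≡y per t-occ qp = q-factor , q-short
  where
  m = length t
  tail-occurrence : ∃ λ s → OccursAt q y s
  tail-occurrence = quasiperiod-occursAt-tail {x = x} c x≡y (proj₁ qp)
  s = proj₁ tail-occurrence
  q-short : length q < 2 * m
  q-short = quasiperiod-length-< {x = x} (>-nonZero⁻¹ m)
    (occursAt-periodic⇒HasPeriod {y = y} {s = s} per (proj₂ tail-occurrence)) qp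
  q-factor : Factor q (t ++ t ++ t)
  q-factor = occursAt-nested⇒Factor {y = y} (occursAt-cube {y = y} t per t-occ)
    (occursAt-%period {y = y} {s = s} per (proj₂ tail-occurrence)) (begin
      s % m + length q     ≤⟨ <⇒≤ (+-mono-< (m%n<n s m) q-short) ⟩
      3 * m                ≡⟨ length-cube t ⟨
      length (t ++ t ++ t) ∎)
    where open ≤-Reasoning

lemma5p2 : {A B : Set} (f : NonErasingMorphism A B) → StronglyQuasiperiodic f →
    ∀ (u : List A) (α : A) (q : List B) → IsQuasiperiodOf q (image f (u · α ^ω)) →
    Factor q (toList (f α) ++ toList (f α) ++ toList (f α))
    × length q < 2 * L⁺.length (f α)
lemma5p2 f _ u α q qp
  with q-factor , q-short ← quasiperiod-in-periodic-tail {x = image f (u · α ^ω)}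
         {{nonZero-length-toList (f α)}} (imageLength f u) (image-·^ω-drop f u α)
         (image-α^ω-periodic f α) (imageGo-at⁺ f (f α) (λ _ → α)) qp
  = q-factor , subst (λ n → length q < 2 * n) (length-toList (f α)) q-short
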